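{- Let $\mathscr D,\mathscr Q$ be disjoint schemas. Every DTGD$[\mathsf{UCQ}]$-ontology $O$ over $(\mathscr D,\mathscr Q)$ is closed under database homomorphisms: if $(D,q)\in O$ and $D'$ is a $\mathscr D$-database with $D\rightarrow_{const(q)}D'$, then $(D',q)\in O$.
   Context: Terms are constants (set $\Delta$), labeled nulls, or variables. A fact is a variable-free relational atom; a database is a finite set of facts without nulls; $adom(D)$ its constants. For a set $C$ of constants, $I\rightarrow_C J$ means there is a map $h$ on the terms of $I$ with $h(I)\subseteq J$ and $h(c)=c$ for $c\in C$. A Boolean UCQ is a sentence built from relational atoms (constants allowed) with only $\wedge,\vee,\exists$; $const(q)$ its constants. A DTGD is a sentence $\forall\mathbf x\forall\mathbf y(\phi\rightarrow\exists\mathbf z(\psi_1\vee\dots\vee\psi_k))$ with $\phi,\psi_i$ conjunctions of relational atoms, every universally quantified variable of the head occurring in $\phi$. $D\cup\Sigma\vDash q$ means every instance containing $D$ and satisfying $\Sigma$ satisfies $q$. An OMQA$[\mathsf{UCQ}]$-ontology over $(\mathscr D,\mathscr Q)$ is a set $O$ of pairs $(D,q)$, $D$ a nonempty $\mathscr D$-database, $q$ a Boolean $\mathscr Q$-UCQ with $const(q)\subseteq adom(D)$, closed under query conjunction ($(D,p),(D,q)\in O\Rightarrow(D,p\wedge q)\in O$), query implication ($q\vDash p$, $(D,q)\in O\Rightarrow(D,p)\in O$), injective $const(q)$-homomorphisms of databases, and partial injective renamings $\tau:\Delta\to\Delta$ ($(D,q)\in O\Rightarrow(\tau(D),\tau(q))\in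 O$). A DTGD$[\mathsf{UCQ}]$-ontology is such an $O$ equal to $\{(D,q): D$ a $\mathscr D$-database, $q$ a Boolean $\mathscr Q$-UCQ, $D\cup\Sigma\vDash q\}$ for some finite set $\Sigma$ of DTGDs. -}

module Defs where

open import Data.Nat using (ℕ; _≟_)
open import Data.Product using (Σ; Σ-syntax; ∃; ∃-syntax; _×_; _,_)
open import Data.Sum using (_⊎_)
open import Data.Empty using (⊥)
open import Data.List using (List; []; _∷_)
open import Data.List.NonEmpty using (List⁺; toList)
open import Data.List.Relation.Unary.All using (All)
open import Data.List.Relation.Unary.Any using (Any)
open import Data.List.Membership.Propositional using (_∈_)
open import Data.Vec using (Vec)
import Data.Vec as Vec
import Data.Vec.Membership.Propositional as VecM
open import Relation.Binary.PropositionalEquality using (_≡_)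
open import Relation.Nullary using (yes; no)
open import Function.Bundles using (_⇔_)

record RelSym : Set where
  constructor mkRel
  field
    name  : ℕ
    arity : ℕ
open RelSym public

Schema : Set₁
Schema = RelSym → Set

Disjoint : Schema → Schema → Set
Disjoint S T = ∀ R → S R → T R → ⊥

record Atom (T : Set) : Set where
  constructor atom
  field
    rel  : RelSym
    args : Vec T (arity rel)
open Atom public

mapAtom : {A B : Set} → (A → B) → Atom A → Atom B
mapAtom f (atom R ts) = atom R (Vec.map f ts)

_occursIn_ : {T : Set} → T → Atom T → Set
t occursIn a = t VecM.∈ args a

Const : Set
Const = ℕ

data GTerm : Set where
  cst  : Const → GTerm
  null : ℕ → GTerm

Instance : Set₁
Instance = Atom GTerm → Set

Database : Set
Database = List (Atom Const)

toFact : Atom Const → Atom GTerm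
toFact = mapAtom cst

IsDatabaseOver : Schema → Database → Set
IsDatabaseOver S D = All (λ a → S (rel a)) D

Nonempty : Database → Set
Nonempty D = Σ (Atom Const) (λ a → a ∈ D)

_∈adom_ : Const → Database → Set
c ∈adom D = Any (λ a → c occursIn a) D

_⊆I_ : Database → Instance → Set
D ⊆I I = ∀ a → a ∈ D → I (toFact a)

HomC : (Const → Set) → Database → Database → Set
HomC C D D' = Σ (Const → Const) λ h →
  (∀ c → C c → h c ≡ c) × (∀ a → a ∈ D → mapAtom h a ∈ D')

data QTerm : Set where
  var : ℕ → QTerm
  con : Const → QTerm

data Query : Set where
  rAtom : Atom QTerm → Query
  _∧Q_  : Query → Query → Query
  _∨Q_  : Query → Query → Query
  ∃Q    : ℕ → Query → Query

Assignment : Set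
Assignment = ℕ → GTerm

update : Assignment → ℕ → GTerm → Assignment
update ν x t y with y ≟ x
... | yes _ = t
... | no  _ = ν y

evalQT : Assignment → QTerm → GTerm
evalQT ν (var x) = ν x
evalQT ν (con c) = cst c

SatQ : Instance → Assignment → Query → Set
SatQ I ν (rAtom a) = I (mapAtom (evalQT ν) a)
SatQ I ν (p ∧Q q)  = SatQ I ν p × SatQ I ν q
SatQ I ν (p ∨Q q)  = SatQ I ν p ⊎ SatQ I ν q
SatQ I ν (∃Q x q)  = Σ GTerm λ t → SatQ I (update ν x t) q

ClosedIn : List ℕ → Query → Set
ClosedIn bs (rAtom a) = ∀ x → var x occursIn a → x ∈ bs
ClosedIn bs (p ∧Q q)  = ClosedIn bs p × ClosedIn bs q
ClosedIn bs (p ∨Q q)  = ClosedIn bs p × ClosedIn bs q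
ClosedIn bs (∃Q x q)  = ClosedIn (x ∷ bs) q

QueryOver : Schema → Query → Set
QueryOver S (rAtom a) = S (rel a)
QueryOver S (p ∧Q q)  = QueryOver S p × QueryOver S q
QueryOver S (p ∨Q q)  = QueryOver S p × QueryOver S q
QueryOver S (∃Q x q)  = QueryOver S q

IsBooleanUCQ : Schema → Query → Set
IsBooleanUCQ S q = ClosedIn [] q × QueryOver S q

ConstOf : Query → Const → Set
ConstOf (rAtom a) c = con c occursIn a
ConstOf (p ∧Q q)  c = ConstOf p c ⊎ ConstOf q c
ConstOf (p ∨Q q)  c = ConstOf p c ⊎ ConstOf q c
ConstOf (∃Q x q)  c = ConstOf q c

-- I satisfies the sentence q (for sentences the assignment is irrelevant)
_⊨Q_ : Instance → Query → Set
I ⊨Q q = ∀ ν → SatQ I ν q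

-- DTGDs (constant-free): body φ, disjunctive head ψ₁ ∨ … ∨ ψₖ (k ≥ 1).
-- Variables of the body are universally quantified; head variables not
-- occurring in the body are the existential variables z.

record DTGD : Set where
  constructor dtgd
  field
    body  : List (Atom ℕ)
    heads : List⁺ (List (Atom ℕ))
open DTGD public

VarOfBody : DTGD → ℕ → Set
VarOfBody σ x = Any (λ a → x occursIn a) (body σ)

SatD : Instance → DTGD → Set
SatD I σ = ∀ (ν : Assignment) →
  All (λ a → I (mapAtom ν a)) (body σ) →
  Any (λ ψ → Σ Assignment λ ν′ →
          (∀ x → VarOfBody σ x → ν′ x ≡ ν x) ×
          All (λ a → I (mapAtom ν′ a)) ψ)
      (toList (heads σ))

SatΣ : Instance → List DTGD → Set
SatΣ I Σs = All (SatD I) Σs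

Entails : Database → List DTGD → Query → Set₁
Entails D Σs q = ∀ (I : Instance) → D ⊆I I → SatΣ I Σs → I ⊨Q q

Ontology : Set₂
Ontology = Database → Query → Set₁

IsDTGDOntologyOf : Schema → Schema → List DTGD → Ontology → Set₁
IsDTGDOntologyOf 𝒟 𝒬 Σs O = ∀ D q → O D q ⇔
  (Nonempty D × IsDatabaseOver 𝒟 D × IsBooleanUCQ 𝒬 q ×
   (∀ c → ConstOf q c → c ∈adom D) × Entails D Σs q)

IsDTGDOntology : Schema → Schema → Ontology → Set₁
IsDTGDOntology 𝒟 𝒬 O = Σ (List DTGD) λ Σs → IsDTGDOntologyOf 𝒟 𝒬 Σs O

-- Let I be a model of D′ and Σ, and extend h to a map g on ground terms that is
-- surjective because nulls are used to code all ground terms.  The preimage of I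
-- under g contains D, since g sends D into D′.  It satisfies Σ: DTGDs are
-- constant-free, so every body match in the preimage maps to one in I, and the
-- head witnesses found in I lift back through a section of g.  Hence the preimage
-- satisfies q, and g maps it into I fixing const(q), so I satisfies q as well.
{-# OPTIONS --safe #-}
module Submission where

open import Defs
open import Data.Nat using (ℕ; zero; suc; _≟_)
open import Data.Product using (Σ; _×_; _,_)
open import Data.Sum using (inj₁; inj₂)
open import Data.Empty using (⊥-elim)
open import Data.List using (List)
open import Data.List.Relation.Unary.All using (All)
import Data.List.Relation.Unary.All as All
open import Data.List.Relation.Unary.Any using (any?)
import Data.List.Relation.Unary.Any as Any
open import Data.List.Membership.Propositional using (find; lose)
open import Data.Vec using (Vec; []; _∷_)
import Data.Vec as Vec
import Data.Vec.Properties as Vec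
import Data.Vec.Membership.Propositional as Vec
import Data.Vec.Relation.Unary.Any as VecAny
open import Data.Vec.Membership.DecPropositional _≟_ using (_∈?_)
open import Data.Vec.Membership.Propositional.Properties using (∈-map⁺)
open import Function using (_∘_; id; Equivalence)
open import Relation.Binary.PropositionalEquality using (_≡_; refl; sym; trans; cong; cong₂; subst)
open import Relation.Nullary using (Dec; yes; no)

mapAtom-∘ : {A B C : Set} (g : B → C) (f : A → B) (a : Atom A) →
  mapAtom g (mapAtom f a) ≡ mapAtom (g ∘ f) a
mapAtom-∘ g f (atom R ts) = cong (atom R) (sym (Vec.map-∘ g f ts))

map-cong-∈ : {A B : Set} {n : ℕ} {f g : A → B} (ts : Vec A n) →
  (∀ x → x Vec.∈ ts → f x ≡ g x) → Vec.map f ts ≡ Vec.map g ts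
map-cong-∈ []       f≗g = refl
map-cong-∈ (t ∷ ts) f≗g =
  cong₂ _∷_ (f≗g t (VecAny.here refl)) (map-cong-∈ ts (λ x → f≗g x ∘ VecAny.there))

mapAtom-cong-occurs : {A B : Set} {f g : A → B} (a : Atom A) →
  (∀ x → x occursIn a → f x ≡ g x) → mapAtom f a ≡ mapAtom g a
mapAtom-cong-occurs (atom R ts) f≗g = cong (atom R) (map-cong-∈ ts f≗g)

mapAtom-cong : {A B : Set} {f g : A → B} (a : Atom A) →
  (∀ x → f x ≡ g x) → mapAtom f a ≡ mapAtom g a
mapAtom-cong a f≗g = mapAtom-cong-occurs a (λ x _ → f≗g x)

occursIn-mapAtom : {A B : Set} (f : A → B) {x : A} (a : Atom A) →
  x occursIn a → f x occursIn mapAtom f a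
occursIn-mapAtom f (atom R ts) = ∈-map⁺ f

double : ℕ → ℕ
double zero    = zero
double (suc n) = suc (suc (double n))

encode : GTerm → ℕ
encode (cst c)  = double c
encode (null n) = suc (double n)

decode : ℕ → GTerm
decode zero          = cst zero
decode (suc zero)    = null zero
decode (suc (suc n)) with decode n
... | cst c  = cst (suc c)
... | null m = null (suc m)

decode-double : ∀ c → decode (double c) ≡ cst c
decode-double zero    = refl
decode-double (suc c) rewrite decode-double c = refl

decode-suc-double : ∀ n → decode (suc (double n)) ≡ null n
decode-suc-double zero    = refl
decode-suc-double (suc n) rewrite decode-suc-double n = refl

decode-encode : ∀ t → decode (encode t) ≡ t
decode-encode (cst c)  = decode-double c
decode-encode (null n) = decode-suc-double n

extend : (Const → Const) → GTerm → GTerm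
extend h (cst c)  = cst (h c)
extend h (null n) = decode n

section : GTerm → GTerm
section t = null (encode t)

extend-section : ∀ h t → extend h (section t) ≡ t
extend-section h = decode-encode

preimage : (GTerm → GTerm) → Instance → Instance
preimage g I f = I (mapAtom g f)

SatQ-cong : ∀ I {ν μ} q → (∀ x → ν x ≡ μ x) → SatQ I ν q → SatQ I μ q
SatQ-cong I (rAtom a) ν≗μ = subst I (mapAtom-cong a evalQT-cong)
  where
  evalQT-cong : ∀ s → evalQT _ s ≡ evalQT _ s
  evalQT-cong (var x) = ν≗μ x
  evalQT-cong (con c) = refl
SatQ-cong I (p ∧Q q) ν≗μ (sp , sq) = SatQ-cong I p ν≗μ sp , SatQ-cong I q ν≗μ sq
SatQ-cong I (p ∨Q q) ν≗μ (inj₁ sp) = inj₁ (SatQ-cong I p ν≗μ sp)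
SatQ-cong I (p ∨Q q) ν≗μ (inj₂ sq) = inj₂ (SatQ-cong I q ν≗μ sq)
SatQ-cong I (∃Q x q) ν≗μ (t , sq) = t , SatQ-cong I q update-cong sq
  where
  update-cong : ∀ y → update _ x t y ≡ update _ x t y
  update-cong y with y ≟ x
  ... | yes _ = refl
  ... | no  _ = ν≗μ y

update-∘ : ∀ (g : GTerm → GTerm) ν x t y →
  g (update ν x t y) ≡ update (g ∘ ν) x (g t) y
update-∘ g ν x t y with y ≟ x
... | yes _ = refl
... | no  _ = refl

SatQ-hom : ∀ (g : GTerm → GTerm) {J I : Instance} → (∀ f → J f → I (mapAtom g f)) →
  ∀ ν q → (∀ c → ConstOf q c → g (cst c) ≡ cst c) →
  SatQ J ν q → SatQ I (g ∘ ν) q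
SatQ-hom g {I = I} J→I ν (rAtom a) fixes s =
  subst I (trans (mapAtom-∘ g (evalQT ν) a) (mapAtom-cong-occurs a g∘eval)) (J→I _ s)
  where
  g∘eval : ∀ s → s occursIn a → g (evalQT ν s) ≡ evalQT (g ∘ ν) s
  g∘eval (var x) _   = refl
  g∘eval (con c) c∈a = fixes c c∈a
SatQ-hom g J→I ν (p ∧Q q) fixes (sp , sq) =
  SatQ-hom g J→I ν p (λ c → fixes c ∘ inj₁) sp , SatQ-hom g J→I ν q (λ c → fixes c ∘ inj₂) sq
SatQ-hom g J→I ν (p ∨Q q) fixes (inj₁ sp) = inj₁ (SatQ-hom g J→I ν p (λ c → fixes c ∘ inj₁) sp)
SatQ-hom g J→I ν (p ∨Q q) fixes (inj₂ sq) = inj₂ (SatQ-hom g J→I ν q (λ c → fixes c ∘ inj₂) sq)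
SatQ-hom g {I = I} J→I ν (∃Q x q) fixes (t , sq) =
  g t , SatQ-cong I q (update-∘ g ν x t) (SatQ-hom g J→I (update ν x t) q fixes sq)

varOfBody? : ∀ σ x → Dec (VarOfBody σ x)
varOfBody? σ x = any? (λ a → x ∈? args a) (body σ)

module _ (g s : GTerm → GTerm) (g∘s : ∀ t → g (s t) ≡ t) (I : Instance) where

  All-preimage : ∀ {ν μ : Assignment} (ψ : List (Atom ℕ)) → (∀ x → g (ν x) ≡ μ x) →
    All (λ a → I (mapAtom μ a)) ψ → All (λ a → preimage g I (mapAtom ν a)) ψ
  All-preimage ψ g∘ν≗μ =
    All.map (λ {a} → subst I (sym (trans (mapAtom-∘ g _ a) (mapAtom-cong a g∘ν≗μ))))

  -- Body variables keep their value; the others take a g-preimage of their witness.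
  SatD-preimage : ∀ σ → SatD I σ → SatD (preimage g I) σ
  SatD-preimage σ sat ν body-in-preimage = Any.map lift (sat (g ∘ ν) body-in-I)
    where
    body-in-I : All (λ a → I (mapAtom (g ∘ ν) a)) (body σ)
    body-in-I = All.map (λ {a} → subst I (mapAtom-∘ g ν a)) body-in-preimage

    lift : ∀ {ψ} → Σ Assignment (λ μ → (∀ x → VarOfBody σ x → μ x ≡ g (ν x)) ×
                                       All (λ a → I (mapAtom μ a)) ψ) →
                   Σ Assignment (λ ν′ → (∀ x → VarOfBody σ x → ν′ x ≡ ν x) ×
                                       All (λ a → preimage g I (mapAtom ν′ a)) ψ)
    lift {ψ} (μ , μ-agrees , head-in-I) = ν′ , ν′-agrees , All-preimage ψ g∘ν′ head-in-I
      where
      ν′ : Assignment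
      ν′ x with varOfBody? σ x
      ... | yes _ = ν x
      ... | no  _ = s (μ x)

      ν′-agrees : ∀ x → VarOfBody σ x → ν′ x ≡ ν x
      ν′-agrees x x∈body with varOfBody? σ x
      ... | yes _       = refl
      ... | no  x∉body = ⊥-elim (x∉body x∈body)

      g∘ν′ : ∀ x → g (ν′ x) ≡ μ x
      g∘ν′ x with varOfBody? σ x
      ... | yes x∈body = sym (μ-agrees x x∈body)
      ... | no  _      = g∘s (μ x)

  SatΣ-preimage : ∀ Σs → SatΣ I Σs → SatΣ (preimage g I) Σs
  SatΣ-preimage Σs = All.map (λ {σ} → SatD-preimage σ)

Nonempty-hom : ∀ {C D D′} → HomC C D D′ → Nonempty D → Nonempty D′
Nonempty-hom (h , _ , D→D′) (a , a∈D) = mapAtom h a , D→D′ a a∈D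

∈adom-hom : ∀ {C D D′} → HomC C D D′ → ∀ c → C c → c ∈adom D → c ∈adom D′
∈adom-hom (h , fixes , D→D′) c c∈C c∈D =
  let a , a∈D , c∈a = find c∈D in
  lose (D→D′ a a∈D) (subst (_occursIn mapAtom h a) (fixes c c∈C) (occursIn-mapAtom h a c∈a))

Entails-hom : ∀ {D D′ Σs q} → HomC (ConstOf q) D D′ → Entails D Σs q → Entails D′ Σs q
Entails-hom {D} {Σs = Σs} {q} (h , fixes , D→D′) D⊨q I D′⊆I I⊨Σ ν =
  SatQ-cong I q (extend-section h ∘ ν)
    (SatQ-hom g (λ _ → id) (section ∘ ν) q (λ c → cong cst ∘ fixes c)
      (D⊨q J D⊆J (SatΣ-preimage g section (extend-section h) I Σs I⊨Σ) (section ∘ ν)))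
  where
  g : GTerm → GTerm
  g = extend h

  J : Instance
  J = preimage g I

  D⊆J : D ⊆I J
  D⊆J a a∈D = subst I (trans (mapAtom-∘ cst h a) (sym (mapAtom-∘ g cst a)))
                      (D′⊆I (mapAtom h a) (D→D′ a a∈D))

proposition2 : (𝒟 𝒬 : Schema) → Disjoint 𝒟 𝒬 →
    (O : Ontology) → IsDTGDOntology 𝒟 𝒬 O →
    (D D′ : Database) (q : Query) → O D q →
    IsDatabaseOver 𝒟 D′ → HomC (ConstOf q) D D′ →
    O D′ q
proposition2 𝒟 𝒬 _ O (Σs , O≡) D D′ q D,q∈O D′-over-𝒟 D→D′ =
  let nonempty , _ , q-UCQ , const⊆adom , D⊨q = Equivalence.to (O≡ D q) D,q∈O in
  Equivalence.from (O≡ D′ q)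
    ( Nonempty-hom D→D′ nonempty
    , D′-over-𝒟
    , q-UCQ
    , (λ c c∈q → ∈adom-hom D→D′ c c∈q (const⊆adom c c∈q))
    , Entails-hom {q = q} D→D′ D⊨q )
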